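{- Let $\mathbf A$ be an SBP-algebra and let $\mathfrak a$ be a prime filter of $\mathbf A$. Then either $\mathfrak a\subseteq\mathfrak a^*$ or $\mathfrak a^*\subseteq\mathfrak a$.
   Context: **SBP-algebras.** An MTL-algebra is a bounded commutative integral residuated lattice $(A,\wedge,\vee,\cdot,\to,0,1)$ with distributive lattice reduct satisfying $(a\to b)\vee(b\to a)=1$. Write $\neg a=a\to0$. An SBP-algebra is an MTL-algebra satisfying $\neg(a^2)\to(\neg\neg a\to a)=1$ and $(2a)^2=2(a^2)$, where $a^2=a\cdot a$ and $2a=\neg(\neg a\cdot\neg a)$. **Filters.** - A prime filter is a proper lattice filter $F$ with $a\vee b\in F\Rightarrow a\in F$ or $b\in F$. - The Routley star is $\mathfrak a^*=\{a\in A:\neg a\notin\mathfrak a\}$. -}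

module Defs where

open import Level using (Level; suc; _⊔_)
open import Data.Product using (_×_; Σ)
open import Data.Sum using (_⊎_)
open import Relation.Nullary using (¬_)
open import Relation.Binary.PropositionalEquality using (_≡_)

record SBPAlgebra (ℓ : Level) : Set (suc ℓ) where
  infixr 6 _∨_
  infixr 7 _∧_
  infixr 8 _·_
  infixr 5 _⇒_
  infix 4 _≤_
  field
    Carrier : Set ℓ
    _∧_ _∨_ _·_ _⇒_ : Carrier → Carrier → Carrier
    𝟘 𝟙 : Carrier
    ∧-comm  : ∀ a b → a ∧ b ≡ b ∧ a
    ∨-comm  : ∀ a b → a ∨ b ≡ b ∨ a
    ∧-assoc : ∀ a b c → (a ∧ b) ∧ c ≡ a ∧ (b ∧ c)
    ∨-assoc : ∀ a b c → (a ∨ b) ∨ c ≡ a ∨ (b ∨ c)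
    ∧-absorbs-∨ : ∀ a b → a ∧ (a ∨ b) ≡ a
    ∨-absorbs-∧ : ∀ a b → a ∨ (a ∧ b) ≡ a
    ∧-distrib-∨ : ∀ a b c → a ∧ (b ∨ c) ≡ (a ∧ b) ∨ (a ∧ c)
    𝟘-bottom : ∀ a → 𝟘 ∧ a ≡ 𝟘
    𝟙-top    : ∀ a → a ∧ 𝟙 ≡ a
    ·-comm   : ∀ a b → a · b ≡ b · a
    ·-assoc  : ∀ a b c → (a · b) · c ≡ a · (b · c)
    ·-identity : ∀ a → a · 𝟙 ≡ a
    -- residuation:  a · b ≤ c  iff  a ≤ b ⇒ c   (x ≤ y means x ∧ y ≡ x)
    residuation₁ : ∀ a b c → (a · b) ∧ c ≡ a · b → a ∧ (b ⇒ c) ≡ a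
    residuation₂ : ∀ a b c → a ∧ (b ⇒ c) ≡ a → (a · b) ∧ c ≡ a · b
    prelinear : ∀ a b → (a ⇒ b) ∨ (b ⇒ a) ≡ 𝟙
    sbp₁ : ∀ a → ((a · a) ⇒ 𝟘) ⇒ (((a ⇒ 𝟘) ⇒ 𝟘) ⇒ a) ≡ 𝟙
    sbp₂ : ∀ a → let 2a = ((a ⇒ 𝟘) · (a ⇒ 𝟘)) ⇒ 𝟘 in
                 2a · 2a ≡ (((a · a) ⇒ 𝟘) · ((a · a) ⇒ 𝟘)) ⇒ 𝟘

  _≤_ : Carrier → Carrier → Set ℓ
  a ≤ b = a ∧ b ≡ a

  ¬' : Carrier → Carrier
  ¬' a = a ⇒ 𝟘

module _ {ℓ : Level} (A : SBPAlgebra ℓ) where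
  open SBPAlgebra A

  Subset : (ℓ' : Level) → Set (ℓ ⊔ suc ℓ')
  Subset ℓ' = Carrier → Set ℓ'

  record IsLatticeFilter {ℓ'} (F : Subset ℓ') : Set (ℓ ⊔ ℓ') where
    field
      contains-𝟙 : F 𝟙
      up-closed  : ∀ {a b} → F a → a ≤ b → F b
      ∧-closed   : ∀ {a b} → F a → F b → F (a ∧ b)

  record IsPrimeFilter {ℓ'} (F : Subset ℓ') : Set (ℓ ⊔ ℓ') where
    field
      isLatticeFilter : IsLatticeFilter F
      proper : Σ Carrier (λ a → ¬ F a)
      prime  : ∀ {a b} → F (a ∨ b) → F a ⊎ F b

  star : ∀ {ℓ'} → Subset ℓ' → Subset ℓ'
  star F a = ¬ F (¬' a)

  _⊆_ : ∀ {ℓ'} → Subset ℓ' → Subset ℓ' → Set (ℓ ⊔ ℓ')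
  F ⊆ G = ∀ {a} → F a → G a

-- In any MTL-algebra prelinearity gives the Kleene inequality a ∧ ¬a ≤ b ∨ ¬b.
-- So if a prime filter contains some a together with ¬a, it contains every
-- b ∨ ¬b and hence, by primeness, b or ¬b: every b with ¬b ∉ 𝔞 lies in 𝔞.
-- Otherwise no a ∈ 𝔞 has ¬a ∈ 𝔞, which is 𝔞 ⊆ 𝔞*.
module Submission where

open import Level using (_⊔_)
open import Function using (id)
open import Data.Sum using (_⊎_; inj₁; inj₂; [_,_])
open import Data.Product using (∃; _×_; _,_)
open import Data.Empty using (⊥-elim)
open import Relation.Nullary using (yes; no)
open import Relation.Binary.PropositionalEquality using (_≡_; sym; trans; cong; cong₂; subst)
open import Axiom.ExcludedMiddle using (ExcludedMiddle)
open import Defs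

module MTLProperties {ℓ} (A : SBPAlgebra ℓ) where
  open SBPAlgebra A

  ∧-idem : ∀ a → a ∧ a ≡ a
  ∧-idem a = trans (cong (a ∧_) (sym (∨-absorbs-∧ a a))) (∧-absorbs-∨ a (a ∧ a))

  ≤-refl : ∀ a → a ≤ a
  ≤-refl = ∧-idem

  ≤-trans : ∀ {a b c} → a ≤ b → b ≤ c → a ≤ c
  ≤-trans {a} {b} {c} a≤b b≤c =
    trans (cong (_∧ c) (sym a≤b)) (trans (∧-assoc a b c) (trans (cong (a ∧_) b≤c) a≤b))

  x∧y≤x : ∀ a b → a ∧ b ≤ a
  x∧y≤x a b = trans (∧-assoc a b a) (trans (cong (a ∧_) (∧-comm b a))
                (trans (sym (∧-assoc a a b)) (cong (_∧ b) (∧-idem a))))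

  x∧y≤y : ∀ a b → a ∧ b ≤ b
  x∧y≤y a b = subst (_≤ b) (∧-comm b a) (x∧y≤x b a)

  x≤x∨y : ∀ a b → a ≤ a ∨ b
  x≤x∨y = ∧-absorbs-∨

  y≤x∨y : ∀ a b → b ≤ a ∨ b
  y≤x∨y a b = subst (b ≤_) (∨-comm b a) (x≤x∨y b a)

  ∨-least : ∀ {a b c} → a ≤ c → b ≤ c → a ∨ b ≤ c
  ∨-least {a} {b} {c} a≤c b≤c =
    trans (∧-comm (a ∨ b) c) (trans (∧-distrib-∨ c a b)
      (cong₂ _∨_ (trans (∧-comm c a) a≤c) (trans (∧-comm c b) b≤c)))

  residuate : ∀ {a b c} → a · b ≤ c → a ≤ b ⇒ c
  residuate {a} {b} {c} = residuation₁ a b c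

  unresiduate : ∀ {a b c} → a ≤ b ⇒ c → a · b ≤ c
  unresiduate {a} {b} {c} = residuation₂ a b c

  ·-identityˡ : ∀ a → 𝟙 · a ≡ a
  ·-identityˡ a = trans (·-comm 𝟙 a) (·-identity a)

  ·-monoˡ-≤ : ∀ {a b} c → a ≤ b → a · c ≤ b · c
  ·-monoˡ-≤ {b = b} c a≤b = unresiduate (≤-trans a≤b (residuate (≤-refl (b · c))))

  ·-monoʳ-≤ : ∀ {a b} c → a ≤ b → c · a ≤ c · b
  ·-monoʳ-≤ {a} {b} c a≤b =
    subst (_≤ c · b) (·-comm a c) (subst (a · c ≤_) (·-comm b c) (·-monoˡ-≤ c a≤b))

  modus-ponens : ∀ a b → (a ⇒ b) · a ≤ b
  modus-ponens a b = unresiduate (≤-refl (a ⇒ b))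

  x·¬x≤𝟘 : ∀ a → a · ¬' a ≤ 𝟘
  x·¬x≤𝟘 a = subst (_≤ 𝟘) (·-comm (¬' a) a) (modus-ponens a 𝟘)

  ≤-by-prelinearity : ∀ a b {x y} → (a ⇒ b) · x ≤ y → (b ⇒ a) · x ≤ y → x ≤ y
  ≤-by-prelinearity a b {x} {y} a⇒b·x≤y b⇒a·x≤y =
    subst (_≤ y) (trans (cong (_· x) (prelinear a b)) (·-identityˡ x))
      (unresiduate (∨-least (residuate a⇒b·x≤y) (residuate b⇒a·x≤y)))

  x∧¬x≤y∨¬y : ∀ a b → a ∧ ¬' a ≤ b ∨ ¬' b
  x∧¬x≤y∨¬y a b = ≤-by-prelinearity a b
    (≤-trans (·-monoʳ-≤ (a ⇒ b) (x∧y≤x a (¬' a)))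
      (≤-trans (modus-ponens a b) (x≤x∨y b (¬' b))))
    (≤-trans (residuate b⇒a·[a∧¬a]·b≤𝟘) (y≤x∨y b (¬' b)))
    where
    b⇒a·[a∧¬a]·b≤𝟘 : ((b ⇒ a) · (a ∧ ¬' a)) · b ≤ 𝟘
    b⇒a·[a∧¬a]·b≤𝟘 =
      subst (_≤ 𝟘) (sym (trans (·-assoc (b ⇒ a) (a ∧ ¬' a) b)
                     (trans (cong ((b ⇒ a) ·_) (·-comm (a ∧ ¬' a) b))
                            (sym (·-assoc (b ⇒ a) b (a ∧ ¬' a))))))
        (≤-trans (·-monoˡ-≤ (a ∧ ¬' a) (modus-ponens b a))
          (≤-trans (·-monoʳ-≤ a (x∧y≤y a (¬' a))) (x·¬x≤𝟘 a)))

module _ {ℓ ℓ'} (A : SBPAlgebra ℓ) {𝔞 : Subset A ℓ'} (prime-𝔞 : IsPrimeFilter A 𝔞) where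
  open SBPAlgebra A
  open IsPrimeFilter prime-𝔞
  open IsLatticeFilter isLatticeFilter
  open MTLProperties A

  contradictory⇒decides : ∀ {a} → 𝔞 a → 𝔞 (¬' a) → ∀ b → 𝔞 b ⊎ 𝔞 (¬' b)
  contradictory⇒decides {a} a∈𝔞 ¬a∈𝔞 b =
    prime (up-closed (∧-closed a∈𝔞 ¬a∈𝔞) (x∧¬x≤y∨¬y a b))

lemma4p13 : ∀ {ℓ ℓ'} → ExcludedMiddle (ℓ ⊔ ℓ') →
    (A : SBPAlgebra ℓ) (𝔞 : Subset A ℓ') →
    IsPrimeFilter A 𝔞 →
    _⊆_ A 𝔞 (star A 𝔞) ⊎ _⊆_ A (star A 𝔞) 𝔞
lemma4p13 em A 𝔞 prime-𝔞 with em {∃ λ a → 𝔞 a × 𝔞 (SBPAlgebra.¬' A a)}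
... | no consistent = inj₁ λ {a} a∈𝔞 ¬a∈𝔞 → consistent (a , a∈𝔞 , ¬a∈𝔞)
... | yes (a , a∈𝔞 , ¬a∈𝔞) =
  inj₂ λ {b} b∈𝔞* → [ id , (λ ¬b∈𝔞 → ⊥-elim (b∈𝔞* ¬b∈𝔞)) ]
                      (contradictory⇒decides A prime-𝔞 a∈𝔞 ¬a∈𝔞 b)
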